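{- Define polynomials $f_n\in\mathbb Z[x]$, $n\ge 0$, by $f_0(x)=-1$, $f_1(x)=-x$ and $f_{n+1}(x) = x f_n(x) - f_{n-1}(x)$ for $n\ge 1$. Then for every $\alpha\in\mathbb Q\setminus\mathbb Z$ we have $f_n(\alpha)\neq 0$ for all $n\in\mathbb N$. -}

module Defs where

open import Data.Nat using (ℕ; zero; suc)
open import Data.Integer as ℤ using (ℤ; +_)
open import Data.List using (List; []; _∷_)
open import Data.Rational as ℚ using (ℚ; _/_)

-- Polynomials in ℤ[x] as coefficient lists, lowest degree first:
-- a₀ ∷ a₁ ∷ … represents a₀ + a₁ x + …
Poly : Set
Poly = List ℤ

infixl 6 _⊕_
_⊕_ : Poly → Poly → Poly
[]       ⊕ q        = q
(a ∷ p)  ⊕ []       = a ∷ p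
(a ∷ p)  ⊕ (b ∷ q)  = (a ℤ.+ b) ∷ (p ⊕ q)

⊖_ : Poly → Poly
⊖ []      = []
⊖ (a ∷ p) = ℤ.- a ∷ ⊖ p

X*_ : Poly → Poly
X* p = + 0 ∷ p

f : ℕ → Poly
f zero             = ℤ.- (+ 1) ∷ []
f (suc zero)       = + 0 ∷ ℤ.- (+ 1) ∷ []
f (suc (suc n))    = X* f (suc n) ⊕ ⊖ f n

ι : ℤ → ℚ
ι z = z / 1

eval : Poly → ℚ → ℚ
eval []      α = ℚ.0ℚ
eval (a ∷ p) α = ι a ℚ.+ α ℚ.* eval p α

-- Write α = a/b in lowest terms and let F n = bⁿ fₙ(a/b). The recurrence becomes
-- F (n+2) = a F (n+1) - b² F n with F 0 = -1 and F 1 = -a, so F is an integer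
-- sequence with F n ≡ -aⁿ (mod b). If fₙ(α) = 0 then F n = 0, so b divides aⁿ;
-- since b is coprime to a, this forces b = 1, i.e. α is an integer.
module Submission where

open import Defs
open import Data.Nat using (ℕ)
open import Data.Integer using (ℤ)
open import Data.Rational using (ℚ; 0ℚ)
open import Data.Product using (∃)
open import Relation.Binary.PropositionalEquality using (_≡_; _≢_)
open import Relation.Nullary using (¬_)

open import Data.Nat.Base as ℕ using (zero; suc)
import Data.Nat.Properties as ℕ
import Data.Nat.Divisibility as ℕ
open import Data.Nat.Coprimality as Coprimality using (Coprime; coprime-divisor)
open import Data.Integer.Base as ℤ using (0ℤ; 1ℤ; -1ℤ; _^_; ∣_∣)
import Data.Integer.Properties as ℤ
open import Data.Integer.Divisibility.Signed
  using (_∣_; divides; ∣⇒∣ᵤ; ∣-refl; ∣m∣n⇒∣m-n; ∣n⇒∣m*n; ∣m⇒∣m*n)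
open import Data.Integer.Tactic.RingSolver using (solve-∀)
open import Data.Rational.Base using (mkℚ; ↥_; ↧_; ↧ₙ_; _+_; _*_; -_; _-_; toℚᵘ; fromℚᵘ)
open import Data.Rational.Properties
  using (toℚᵘ-injective; toℚᵘ-fromℚᵘ; fromℚᵘ-injective; fromℚᵘ-cong;
         toℚᵘ-homo-+; toℚᵘ-homo-*; toℚᵘ-homo‿-; ↥p/↧p≡p;
         +-identityˡ; +-identityʳ; *-identityˡ; *-zeroʳ)
open import Data.Rational.Solver using (module +-*-Solver)
open +-*-Solver using (solve; _:+_; _:*_; :-_; _:-_; _:=_)
import Data.Rational.Unnormalised.Base as ℚᵘ
open import Data.Rational.Unnormalised.Base using (mkℚᵘ; *≡*)
import Data.Rational.Unnormalised.Properties as ℚᵘ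
open import Data.Product using (_,_)
open import Data.List using ([]; _∷_)
open import Relation.Binary.PropositionalEquality
  using (refl; sym; trans; cong; cong₂; subst; module ≡-Reasoning)

fromℚᵘ-homo-+ : ∀ p q → fromℚᵘ (p ℚᵘ.+ q) ≡ fromℚᵘ p + fromℚᵘ q
fromℚᵘ-homo-+ p q = toℚᵘ-injective (begin
  toℚᵘ (fromℚᵘ (p ℚᵘ.+ q))                    ≈⟨ toℚᵘ-fromℚᵘ (p ℚᵘ.+ q) ⟩
  p ℚᵘ.+ q                                    ≈⟨ ℚᵘ.+-cong (toℚᵘ-fromℚᵘ p) (toℚᵘ-fromℚᵘ q) ⟨
  toℚᵘ (fromℚᵘ p) ℚᵘ.+ toℚᵘ (fromℚᵘ q)        ≈⟨ toℚᵘ-homo-+ (fromℚᵘ p) (fromℚᵘ q) ⟨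
  toℚᵘ (fromℚᵘ p + fromℚᵘ q)                  ∎)
  where open ℚᵘ.≃-Reasoning

fromℚᵘ-homo-* : ∀ p q → fromℚᵘ (p ℚᵘ.* q) ≡ fromℚᵘ p * fromℚᵘ q
fromℚᵘ-homo-* p q = toℚᵘ-injective (begin
  toℚᵘ (fromℚᵘ (p ℚᵘ.* q))                    ≈⟨ toℚᵘ-fromℚᵘ (p ℚᵘ.* q) ⟩
  p ℚᵘ.* q                                    ≈⟨ ℚᵘ.*-cong (toℚᵘ-fromℚᵘ p) (toℚᵘ-fromℚᵘ q) ⟨
  toℚᵘ (fromℚᵘ p) ℚᵘ.* toℚᵘ (fromℚᵘ q)        ≈⟨ toℚᵘ-homo-* (fromℚᵘ p) (fromℚᵘ q) ⟨
  toℚᵘ (fromℚᵘ p * fromℚᵘ q)                  ∎)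
  where open ℚᵘ.≃-Reasoning

fromℚᵘ-homo‿- : ∀ p → fromℚᵘ (ℚᵘ.- p) ≡ - fromℚᵘ p
fromℚᵘ-homo‿- p = toℚᵘ-injective (begin
  toℚᵘ (fromℚᵘ (ℚᵘ.- p))    ≈⟨ toℚᵘ-fromℚᵘ (ℚᵘ.- p) ⟩
  ℚᵘ.- p                    ≈⟨ ℚᵘ.-‿cong (toℚᵘ-fromℚᵘ p) ⟨
  ℚᵘ.- toℚᵘ (fromℚᵘ p)      ≈⟨ toℚᵘ-homo‿- (fromℚᵘ p) ⟨
  toℚᵘ (- fromℚᵘ p)         ∎)
  where open ℚᵘ.≃-Reasoning

-- ι i is definitionally fromℚᵘ (mkℚᵘ i 0), which reduces ι's properties to those of fromℚᵘ.
ι-homo-+ : ∀ i j → ι (i ℤ.+ j) ≡ ι i + ι j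
ι-homo-+ i j = trans (fromℚᵘ-cong ≃-sum) (fromℚᵘ-homo-+ (mkℚᵘ i 0) (mkℚᵘ j 0))
  where
  lemma : ∀ i j → (i ℤ.+ j) ℤ.* 1ℤ ≡ (i ℤ.* 1ℤ ℤ.+ j ℤ.* 1ℤ) ℤ.* 1ℤ
  lemma = solve-∀
  ≃-sum : mkℚᵘ (i ℤ.+ j) 0 ℚᵘ.≃ mkℚᵘ i 0 ℚᵘ.+ mkℚᵘ j 0
  ≃-sum = *≡* (lemma i j)

ι-homo-* : ∀ i j → ι (i ℤ.* j) ≡ ι i * ι j
ι-homo-* i j = fromℚᵘ-homo-* (mkℚᵘ i 0) (mkℚᵘ j 0)

ι-homo‿- : ∀ i → ι (ℤ.- i) ≡ - ι i
ι-homo‿- i = fromℚᵘ-homo‿- (mkℚᵘ i 0)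

ι-homo-minus : ∀ i j → ι (i ℤ.- j) ≡ ι i - ι j
ι-homo-minus i j = trans (ι-homo-+ i (ℤ.- j)) (cong (ι i +_) (ι-homo‿- j))

ι-injective : ∀ {i j} → ι i ≡ ι j → i ≡ j
ι-injective {i} {j} ιi≡ιj with fromℚᵘ-injective {mkℚᵘ i 0} {mkℚᵘ j 0} ιi≡ιj
... | *≡* i*1≡j*1 = trans (sym (ℤ.*-identityʳ i)) (trans i*1≡j*1 (ℤ.*-identityʳ j))

*-↧≡ι↥ : ∀ α → α * ι (↧ α) ≡ ι (↥ α)
*-↧≡ι↥ α@(mkℚ a d _) = begin
  α * ι (↧ α)                          ≡⟨ cong (_* ι (↧ α)) (↥p/↧p≡p α) ⟨
  fromℚᵘ (mkℚᵘ a d) * ι (↧ α)          ≡⟨ fromℚᵘ-homo-* (mkℚᵘ a d) (mkℚᵘ (↧ α) 0) ⟨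
  fromℚᵘ (mkℚᵘ a d ℚᵘ.* mkℚᵘ (↧ α) 0)  ≡⟨ fromℚᵘ-cong cancel ⟩
  ι a                                  ∎
  where
  open ≡-Reasoning
  lemma : ∀ a b → a ℤ.* b ℤ.* 1ℤ ≡ a ℤ.* b
  lemma = solve-∀
  cancel : mkℚᵘ a d ℚᵘ.* mkℚᵘ (↧ α) 0 ℚᵘ.≃ mkℚᵘ a 0
  cancel = *≡* (trans (lemma a (↧ α)) (cong (λ m → a ℤ.* ℤ.+ m) (sym (ℕ.*-identityʳ (suc d)))))

module _ (α : ℚ) where

  eval-X* : ∀ p → eval (X* p) α ≡ α * eval p α
  eval-X* p = +-identityˡ (α * eval p α)

  eval-⊕ : ∀ p q → eval (p ⊕ q) α ≡ eval p α + eval q α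
  eval-⊕ []      q       = sym (+-identityˡ (eval q α))
  eval-⊕ (a ∷ p) []      = sym (+-identityʳ (eval (a ∷ p) α))
  eval-⊕ (a ∷ p) (b ∷ q) = begin
    ι (a ℤ.+ b) + α * eval (p ⊕ q) α
      ≡⟨ cong₂ (λ u v → u + α * v) (ι-homo-+ a b) (eval-⊕ p q) ⟩
    (ι a + ι b) + α * (eval p α + eval q α)
      ≡⟨ lemma (ι a) (ι b) α (eval p α) (eval q α) ⟩
    (ι a + α * eval p α) + (ι b + α * eval q α) ∎
    where
    open ≡-Reasoning
    lemma : ∀ x y z u v → (x + y) + z * (u + v) ≡ (x + z * u) + (y + z * v)
    lemma = solve 5 (λ x y z u v → (x :+ y) :+ z :* (u :+ v)
                                   := (x :+ z :* u) :+ (y :+ z :* v)) refl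

  eval-⊖ : ∀ p → eval (⊖ p) α ≡ - eval p α
  eval-⊖ []      = refl
  eval-⊖ (a ∷ p) = begin
    ι (ℤ.- a) + α * eval (⊖ p) α  ≡⟨ cong₂ (λ u v → u + α * v) (ι-homo‿- a) (eval-⊖ p) ⟩
    - ι a + α * (- eval p α)      ≡⟨ lemma (ι a) α (eval p α) ⟩
    - (ι a + α * eval p α)        ∎
    where
    open ≡-Reasoning
    lemma : ∀ x z u → - x + z * (- u) ≡ - (x + z * u)
    lemma = solve 3 (λ x z u → :- x :+ z :* (:- u) := :- (x :+ z :* u)) refl

  eval-f-0 : eval (f 0) α ≡ ι -1ℤ
  eval-f-0 = trans (cong (ι -1ℤ +_) (*-zeroʳ α)) (+-identityʳ (ι -1ℤ))

  eval-f-suc-suc : ∀ n → eval (f (suc (suc n))) α ≡ α * eval (f (suc n)) α - eval (f n) α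
  eval-f-suc-suc n = trans (eval-⊕ (X* f (suc n)) (⊖ f n))
    (cong₂ _+_ (eval-X* (f (suc n))) (eval-⊖ (f n)))

F : ℤ → ℤ → ℕ → ℤ
F a b zero          = -1ℤ
F a b (suc zero)    = ℤ.- a
F a b (suc (suc n)) = a ℤ.* F a b (suc n) ℤ.- b ℤ.* b ℤ.* F a b n

∣F+^ : ∀ a b n → b ∣ F a b n ℤ.+ a ^ n
∣F+^ a b zero          = divides 0ℤ refl
∣F+^ a b (suc zero)    = subst (b ∣_) (sym -a+a¹≡0) (divides 0ℤ refl)
  where
  -a+a¹≡0 : ℤ.- a ℤ.+ a ^ 1 ≡ 0ℤ
  -a+a¹≡0 = trans (cong (λ x → ℤ.- a ℤ.+ x) (ℤ.^-identityʳ a)) (ℤ.+-inverseˡ a)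
∣F+^ a b (suc (suc n)) = subst (b ∣_) (sym (lemma a b (F a b (suc n)) (F a b n) (a ^ n)))
  (∣m∣n⇒∣m-n (∣n⇒∣m*n a (∣F+^ a b (suc n))) (∣m⇒∣m*n (b ℤ.* F a b n) ∣-refl))
  where
  lemma : ∀ a b x y z → a ℤ.* x ℤ.- b ℤ.* b ℤ.* y ℤ.+ a ℤ.* (a ℤ.* z)
                      ≡ a ℤ.* (x ℤ.+ a ℤ.* z) ℤ.- b ℤ.* (b ℤ.* y)
  lemma = solve-∀

ι^*eval-f≡ιF : ∀ {α a b} → α * ι b ≡ ι a → ∀ n → ι (b ^ n) * eval (f n) α ≡ ι (F a b n)
ι^*eval-f≡ιF {α} {a} {b} α*ιb≡ιa = go
  where
  open ≡-Reasoning
  e : ℕ → ℚ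
  e n = eval (f n) α

  ι-b^suc : ∀ n → ι (b ^ suc n) ≡ ι b * ι (b ^ n)
  ι-b^suc n = ι-homo-* b (b ^ n)

  go : ∀ n → ι (b ^ n) * e n ≡ ι (F a b n)
  go zero = trans (*-identityˡ (e 0)) (eval-f-0 α)
  go (suc zero) = begin
    ι (b ^ 1) * e 1             ≡⟨ cong₂ _*_ (cong ι (ℤ.^-identityʳ b)) (eval-X* α (f 0)) ⟩
    ι b * (α * e 0)             ≡⟨ lemma (ι b) α (e 0) ⟩
    (α * ι b) * e 0             ≡⟨ cong₂ _*_ α*ιb≡ιa (eval-f-0 α) ⟩
    ι a * ι -1ℤ                 ≡⟨ ι-homo-* a -1ℤ ⟨
    ι (a ℤ.* -1ℤ)               ≡⟨ cong ι (trans (ℤ.*-comm a -1ℤ) (ℤ.-1*i≡-i a)) ⟩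
    ι (ℤ.- a)                   ∎
    where
    lemma : ∀ x y z → x * (y * z) ≡ (y * x) * z
    lemma = solve 3 (λ x y z → x :* (y :* z) := (y :* x) :* z) refl
  go (suc (suc n)) = begin
    ι (b ^ suc (suc n)) * e (suc (suc n))
      ≡⟨ cong₂ _*_ (trans (ι-b^suc (suc n)) (cong (ι b *_) (ι-b^suc n))) (eval-f-suc-suc α n) ⟩
    (ι b * (ι b * ι (b ^ n))) * (α * e (suc n) - e n)
      ≡⟨ lemma (ι b) (ι (b ^ n)) α (e (suc n)) (e n) ⟩
    (α * ι b) * (ι b * ι (b ^ n) * e (suc n)) - ι b * ι b * (ι (b ^ n) * e n)
      ≡⟨ cong₂ _-_ (cong₂ _*_ α*ιb≡ιa (trans (cong (_* e (suc n)) (sym (ι-b^suc n))) (go (suc n))))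
                   (cong (ι b * ι b *_) (go n)) ⟩
    ι a * ι (F a b (suc n)) - ι b * ι b * ι (F a b n)
      ≡⟨ cong₂ _-_ (ι-homo-* a (F a b (suc n)))
                   (trans (ι-homo-* (b ℤ.* b) (F a b n)) (cong (_* ι (F a b n)) (ι-homo-* b b))) ⟨
    ι (a ℤ.* F a b (suc n)) - ι (b ℤ.* b ℤ.* F a b n)
      ≡⟨ ι-homo-minus (a ℤ.* F a b (suc n)) (b ℤ.* b ℤ.* F a b n) ⟨
    ι (F a b (suc (suc n)))
      ∎
    where
    lemma : ∀ x p y u v → (x * (x * p)) * (y * u - v) ≡ (y * x) * (x * p * u) - x * x * (p * v)
    lemma = solve 5 (λ x p y u v → (x :* (x :* p)) :* (y :* u :- v)
                                   := (y :* x) :* (x :* p :* u) :- x :* x :* (p :* v)) refl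

↧ₙ≡1⇒≡ι↥ : ∀ α → ↧ₙ α ≡ 1 → α ≡ ι (↥ α)
↧ₙ≡1⇒≡ι↥ α@(mkℚ _ zero _) refl = sym (↥p/↧p≡p α)

∣^∣≡∣∣^ : ∀ i n → ∣ i ^ n ∣ ≡ ∣ i ∣ ℕ.^ n
∣^∣≡∣∣^ i zero    = refl
∣^∣≡∣∣^ i (suc n) = trans (ℤ.abs-* i (i ^ n)) (cong (∣ i ∣ ℕ.*_) (∣^∣≡∣∣^ i n))

coprime-∣^⇒∣1 : ∀ {m n} k → Coprime m n → m ℕ.∣ n ℕ.^ k → m ℕ.∣ 1
coprime-∣^⇒∣1 zero    _      m∣1     = m∣1
coprime-∣^⇒∣1 (suc k) coprime m∣nⁿ⁺¹ = coprime-∣^⇒∣1 k coprime (coprime-divisor coprime m∣nⁿ⁺¹)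

↧∣↥^⇒↧ₙ≡1 : ∀ α n → ↧ α ∣ ↥ α ^ n → ↧ₙ α ≡ 1
↧∣↥^⇒↧ₙ≡1 (mkℚ a d coprime) n ↧∣↥ⁿ = ℕ.∣1⇒≡1 (coprime-∣^⇒∣1 n
  (Coprimality.sym (Coprimality.recompute coprime))
  (subst (suc d ℕ.∣_) (∣^∣≡∣∣^ a n) (∣⇒∣ᵤ ↧∣↥ⁿ)))

lemma3p1 : (α : ℚ) → ¬ (∃ λ (z : ℤ) → α ≡ ι z) →
    (n : ℕ) → eval (f n) α ≢ 0ℚ
lemma3p1 α α∉ℤ n fₙ[α]≡0 = α∉ℤ (↥ α , ↧ₙ≡1⇒≡ι↥ α (↧∣↥^⇒↧ₙ≡1 α n ↧α∣↥αⁿ))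
  where
  open ≡-Reasoning
  Fₙ≡0 : F (↥ α) (↧ α) n ≡ 0ℤ
  Fₙ≡0 = ι-injective (begin
    ι (F (↥ α) (↧ α) n)              ≡⟨ ι^*eval-f≡ιF (*-↧≡ι↥ α) n ⟨
    ι (↧ α ^ n) * eval (f n) α       ≡⟨ cong (ι (↧ α ^ n) *_) fₙ[α]≡0 ⟩
    ι (↧ α ^ n) * 0ℚ                 ≡⟨ *-zeroʳ (ι (↧ α ^ n)) ⟩
    0ℚ                               ∎)
  ↧α∣↥αⁿ : ↧ α ∣ ↥ α ^ n
  ↧α∣↥αⁿ = subst (↧ α ∣_) (trans (cong (ℤ._+ ↥ α ^ n) Fₙ≡0) (ℤ.+-identityˡ (↥ α ^ n)))
    (∣F+^ (↥ α) (↧ α) n)
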